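{- Let $H$ and $K$ be $2$-connected cubic graphs, where $H$ is a snark with $\pi(H)\ge5$ and $K$ is a $3$-edge-colourable quasi-bipartite graph with a bipartising set $U$. Let $G=H\oplus_3K$ be a $3$-sum with distinguished vertices $u\in V(H)$ and $v\in V(K)$, where $\{v\}$ is a component of $K-U$. Then: (i) $\pi(G)\ge5$; (ii) $G$ is quasi-bipartite with bipartising set $U$, and $H-u$ is a member of the corresponding quasi-partite set of $G$ (i.e. a component of $G-U$), replacing $\{v\}$.
   Context: Graphs are finite; multiple edges and loops permitted. A snark is a $2$-connected cubic graph with no proper $3$-edge-colouring. $\pi(G)$, the perfect matching index, is the minimum number of perfect matchings whose union is $E(G)$. $3$-sum $H\oplus_3K$: with distinguished vertices $u\in V(H)$, $v\in V(K)$, delete $u,v$ and join the three edge-ends formerly at $u$ bijectively to the three edge-ends formerly at $v$. A $2$-connected cubic graph $K$ is quasi-bipartite if it has an independent vertex set $U$ with $|U|\ge2$ (a bipartising set) such that $K/(K-U)$, obtained by contracting each component of $K-U$ to one vertex, is a bipartite cubic graph (possibly with multiple edges) with partite sets $U$ and the contracted vertices; the set of components of $K-U$ is the quasi-partite set. -}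

module Defs where

open import Data.Bool using (Bool; true; false)
open import Data.Nat using (ℕ; _≤_)
open import Data.Fin using (Fin; punchIn; punchOut; _≟_)
open import Data.Product using (Σ; ∃; _×_; _,_; proj₁; proj₂)
open import Data.Sum using (_⊎_; inj₁; inj₂)
open import Data.Unit using (⊤)
open import Data.Empty using (⊥)
open import Data.List using (List; length)
open import Data.List.Relation.Unary.All using (All)
open import Data.List.Relation.Unary.Any using (Any)
open import Function.Bundles using (_↔_; Inverse; _⇔_)
open import Relation.Nullary using (¬_; yes; no)
open import Relation.Binary.PropositionalEquality using (_≡_; _≢_; sym)

-- Cubic multigraphs (loops and parallel edges allowed), half-edge model.
-- Every vertex x carries exactly three darts (half-edges) (x , 0), (x , 1),
-- (x , 2); an edge is a pair {d , partner d} of darts.  A loop at x is a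
-- pair of darts both at x; parallel edges are distinct pairs of darts with
-- the same end-vertices.

Dart : Set → Set
Dart V = V × Fin 3

record CubicRaw (V : Set) : Set where
  field
    partner : Dart V → Dart V
open CubicRaw public

vtx : {V : Set} → Dart V → V
vtx = proj₁

IsCubic : {V : Set} → CubicRaw V → Set
IsCubic {V} G = (∀ (d : Dart V) → partner G (partner G d) ≡ d)
              × (∀ (d : Dart V) → partner G d ≢ d)

data Path {V : Set} (G : CubicRaw V) (P : V → Set) (E : Dart V → Set)
          : V → V → Set where
  here : ∀ {x} → P x → Path G P E x x
  step : ∀ {x y} (i : Fin 3) → P x → E (x , i)
       → Path G P E (vtx (partner G (x , i))) y → Path G P E x y

Connected : {V : Set} → CubicRaw V → Set
Connected {V} G = ∀ (x y : V) → Path G (λ _ → ⊤) (λ _ → ⊤) x y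

AvoidEdge : {V : Set} → CubicRaw V → Dart V → Dart V → Set
AvoidEdge G d d' = (d' ≢ d) × (d' ≢ partner G d)

-- 2-connected (for cubic graphs: connected and bridgeless)
TwoConnected : {V : Set} → CubicRaw V → Set
TwoConnected {V} G =
  Connected G ×
  (∀ (d : Dart V) (x y : V) → Path G (λ _ → ⊤) (AvoidEdge G d) x y)

ProperColouring : {V : Set} → CubicRaw V → (Dart V → Fin 3) → Set
ProperColouring {V} G c =
  (∀ (d : Dart V) → c (partner G d) ≡ c d) ×
  (∀ (x : V) (i j : Fin 3) → c (x , i) ≡ c (x , j) → i ≡ j)

ThreeEdgeColourable : {V : Set} → CubicRaw V → Set
ThreeEdgeColourable {V} G = Σ (Dart V → Fin 3) (ProperColouring G)

Snark : {V : Set} → CubicRaw V → Set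
Snark G = TwoConnected G × ¬ ThreeEdgeColourable G

-- a set of edges, given as a set of darts closed under partner,
-- containing exactly one dart at each vertex
PerfectMatching : {V : Set} → CubicRaw V → (Dart V → Bool) → Set
PerfectMatching {V} G M =
  (∀ (d : Dart V) → M (partner G d) ≡ M d) ×
  (∀ (x : V) → Σ (Fin 3) λ i → (M (x , i) ≡ true) ×
                 (∀ (j : Fin 3) → M (x , j) ≡ true → j ≡ i))

Covers : {V : Set} → List (Dart V → Bool) → Set
Covers {V} Ms = ∀ (d : Dart V) → Any (λ M → M d ≡ true) Ms

PMIndexAtMost : {V : Set} → CubicRaw V → ℕ → Set
PMIndexAtMost {V} G n =
  Σ (List (Dart V → Bool)) λ Ms →
    (length Ms ≤ n) × All (PerfectMatching G) Ms × Covers Ms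

PMIndexAtLeast5 : {V : Set} → CubicRaw V → Set
PMIndexAtLeast5 G = ¬ PMIndexAtMost G 4

InComp : {V : Set} → CubicRaw V → (V → Bool) → V → V → Set
InComp G U x y = Path G (λ w → U w ≡ false) (λ _ → ⊤) x y

Independent : {V : Set} → CubicRaw V → (V → Bool) → Set
Independent {V} G U =
  ∀ (d : Dart V) → U (vtx d) ≡ true → U (vtx (partner G d)) ≡ true → ⊥

-- K / (K - U) is bipartite with partite sets U and the contracted
-- components, and cubic.  Edges inside a component are contracted away;
-- the remaining edges are:
--   * no edge joins two vertices of U, and no edge joins two different
--     components of K - U (bipartite with the given partite sets);
--   * every contracted vertex (component C, represented by any x ∉ U) has
--     degree exactly 3: there are exactly three darts d with vtx d ∈ C and
--     the other end of d in U (vertices of U then automatically have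
--     degree 3).
ContractionBipartiteCubic : {V : Set} → CubicRaw V → (V → Bool) → Set
ContractionBipartiteCubic {V} G U =
  Independent G U ×
  (∀ (d : Dart V) → U (vtx d) ≡ false → U (vtx (partner G d)) ≡ false →
     InComp G U (vtx d) (vtx (partner G d))) ×
  (∀ (x : V) → U x ≡ false →
     Σ (Fin 3 → Dart V) λ f →
       (∀ (i j : Fin 3) → f i ≡ f j → i ≡ j) ×
       (∀ (i : Fin 3) → InComp G U x (vtx (f i)) ×
                        (U (vtx (partner G (f i))) ≡ true)) ×
       (∀ (d : Dart V) → InComp G U x (vtx d) →
          U (vtx (partner G d)) ≡ true → Σ (Fin 3) λ i → f i ≡ d))

BipartisingSet : {V : Set} → CubicRaw V → (V → Bool) → Set
BipartisingSet {V} G U =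
  (Σ V λ a → Σ V λ b → (a ≢ b) × (U a ≡ true) × (U b ≡ true)) ×
  ContractionBipartiteCubic G U

QuasiBipartiteWith : {V : Set} → CubicRaw V → (V → Bool) → Set
QuasiBipartiteWith G U = TwoConnected G × BipartisingSet G U

-- The sum has vertex set
-- Fin h ⊎ Fin k: inj₁ a is the vertex punchIn u a of H - u, inj₂ b is the
-- vertex punchIn v b of K - v.  The bijection σ joins the edge-end
-- formerly at dart (u , i) to the edge-end formerly at dart (v , σ i).
-- (If u or v carries a loop the construction is degenerate; this never
-- happens for 2-connected graphs.)

module _ {h k : ℕ} (H : CubicRaw (Fin (ℕ.suc h))) (u : Fin (ℕ.suc h))
         (K : CubicRaw (Fin (ℕ.suc k))) (v : Fin (ℕ.suc k))
         (σ : Fin 3 ↔ Fin 3) where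

  private
    to = Inverse.to σ
    from = Inverse.from σ

    fromK : Dart (Fin h ⊎ Fin k) → Dart (Fin (ℕ.suc k)) → Dart (Fin h ⊎ Fin k)
    fromK dflt (y , l) with v ≟ y
    ... | yes _  = dflt
    ... | no v≢y = (inj₂ (punchOut v≢y) , l)

    fromH : Dart (Fin h ⊎ Fin k) → Dart (Fin (ℕ.suc h)) → Dart (Fin h ⊎ Fin k)
    fromH dflt (x , l) with u ≟ x
    ... | yes _  = dflt
    ... | no u≢x = (inj₁ (punchOut u≢x) , l)

    sumPartner : Dart (Fin h ⊎ Fin k) → Dart (Fin h ⊎ Fin k)
    sumPartner (inj₁ a , j) with partner H (punchIn u a , j)
    ... | (x , i) with u ≟ x
    ...   | yes _  = fromK (inj₁ a , j) (partner K (v , to i))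
    ...   | no u≢x = (inj₁ (punchOut u≢x) , i)
    sumPartner (inj₂ b , j) with partner K (punchIn v b , j)
    ... | (y , i) with v ≟ y
    ...   | yes _  = fromH (inj₂ b , j) (partner H (u , from i))
    ...   | no v≢y = (inj₂ (punchOut v≢y) , i)

  ThreeSum : CubicRaw (Fin h ⊎ Fin k)
  ThreeSum = record { partner = sumPartner }

liftU : {h k : ℕ} → (v : Fin (ℕ.suc k)) → (Fin (ℕ.suc k) → Bool)
      → (Fin h ⊎ Fin k) → Bool
liftU v U (inj₁ _) = false
liftU v U (inj₂ b) = U (punchIn v b)

{-# OPTIONS --safe #-}
module Submission where

-- In G = H ⊕₃ K the graph H - u is joined to K - v by three edges between their stubs, the darts
-- that used to meet u and v.  After deleting any edge of G, the 2-connectivity of H and K still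
-- leads every vertex within its side to an undeleted joining edge, so G is 2-connected.  As {v}
-- is a component of K - U, every neighbour of v lies in U; hence H - u is a component of G - U
-- whose cut consists of the three joining edges, and the other components are those of K - U.
-- In a quasi-bipartite graph every perfect matching M meets the cut of each component C exactly
-- once: an odd number of times because 3|C| - 3 is even, and not three times because the cuts
-- meet M in |U| edges altogether (one at each vertex of U) while there are |U| components (U is
-- independent and each component has three boundary edges).  So every perfect matching of G
-- restricts to one of H, and a cover of G by four perfect matchings would give one of H.

open import Defs
import Data.Nat.Properties as ℕ
open import Algebra.Properties.Semiring.Sum ℕ.+-*-semiring as ℕSum
  using (sum; sum-syntax; sum-cong-≗; sum-replicate-zero; ∑-distrib-+; sum-permute; *-distribˡ-sum)
open import Data.Bool using (Bool; true; false; not)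
open import Data.Empty using (⊥; ⊥-elim)
open import Data.Fin as Fin
  using (Fin; zero; suc; punchIn; punchOut; _↑ˡ_; _↑ʳ_; combine; remQuot; _<?_)
open import Data.Fin.Patterns using (0F; 1F; 2F)
open import Data.Fin.Properties
  using (suc-injective; remQuot-combine; combine-remQuot; <-cmp; +↔⊎; punchInᵢ≢i; punchOut-cong;
         punchOut-punchIn; punchIn-punchOut; punchIn-injective)
import Data.List as List
open import Data.List.Properties using (length-map)
import Data.List.Relation.Unary.All as All
import Data.List.Relation.Unary.All.Properties as All
import Data.List.Relation.Unary.Any.Properties as Any
open import Data.Nat using (ℕ; zero; suc; _+_; _*_; _≤_; _<_; z≤n)
open import Data.Nat.Divisibility using (_∣_; divides; _∣0; ∣m+n∣m⇒∣n; ∣m∣n⇒∣m+n; ∣n⇒∣m*n)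
open import Data.Nat.Properties
  using (m+n≡0⇒m≡0; m+n≡0⇒n≡0; +-assoc; +-identityʳ; *-comm; *-zeroʳ; *-identityˡ; *-identityʳ;
         *-distribʳ-+; +-mono-≤; +-mono-<-≤; +-mono-≤-<; *-monoʳ-≤; ≤-antisym; ≮⇒≥; n≢0⇒n>0;
         <-irrefl; ≤-trans; ≤-reflexive; module ≤-Reasoning)
open import Data.Product using (Σ; ∃; _×_; _,_; proj₁; proj₂; map; map₁)
open import Data.Sum using (_⊎_; inj₁; inj₂; swap)
open import Data.Sum.Properties using (inj₁-injective; inj₂-injective)
open import Data.Unit using (⊤; tt)
open import Function.Base using (_∘_; id)
open import Function.Bundles using (_↔_; _⇔_; Inverse; mk↔ₛ′; mk⇔)
open import Function.Construct.Composition using (_↔-∘_)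
open import Function.Construct.Symmetry using (↔-sym)
open import Relation.Binary.Definitions using (tri<; tri≈; tri>)
open import Relation.Binary.PropositionalEquality
  using (_≡_; _≢_; refl; sym; trans; cong; cong₂; subst; module ≡-Reasoning)
open import Relation.Nullary using (¬_; Dec; does; yes; no)
open import Relation.Nullary.Decidable using (dec-true; dec-false; map′; ¬¬-excluded-middle)

true≢false : true ≢ false
true≢false ()

χ : Bool → ℕ
χ true  = 1
χ false = 0

ExactlyOne : ∀ {n} → (Fin n → Bool) → Set
ExactlyOne {n} b = Σ (Fin n) λ i → (b i ≡ true) × (∀ j → b j ≡ true → j ≡ i)

ExactlyOne-≗ : ∀ {n} {b c : Fin n → Bool} → (∀ i → b i ≡ c i) → ExactlyOne b → ExactlyOne c
ExactlyOne-≗ b≗c (i , bᵢ , unique) =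
  i , trans (sym (b≗c i)) bᵢ , λ j cⱼ → unique j (trans (b≗c j) cⱼ)

sum-zero : ∀ {n} {f : Fin n → ℕ} → (∀ i → f i ≡ 0) → sum f ≡ 0
sum-zero {n} f≡0 = trans (sum-cong-≗ f≡0) (sum-replicate-zero n)

sum-single : ∀ {n} {f : Fin n → ℕ} i → (∀ j → j ≢ i → f j ≡ 0) → sum f ≡ f i
sum-single {suc n} {f} zero f≡0 =
  trans (cong (f zero +_) (sum-zero (λ j → f≡0 (suc j) λ ()))) (+-identityʳ (f zero))
sum-single {suc n} {f} (suc i) f≡0 =
  cong₂ _+_ (f≡0 zero λ ()) (sum-single i (λ j j≢i → f≡0 (suc j) (j≢i ∘ suc-injective)))

sum≡0 : ∀ {n} (f : Fin n → ℕ) → sum f ≡ 0 → ∀ i → f i ≡ 0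
sum≡0 f s zero    = m+n≡0⇒m≡0 (f zero) s
sum≡0 f s (suc i) = sum≡0 (f ∘ suc) (m+n≡0⇒n≡0 (f zero) s) i

χ≡0 : ∀ {b} → χ b ≡ 0 → b ≡ false
χ≡0 {false} _ = refl

sum-χ≡1⇒ExactlyOne : ∀ {n} (b : Fin n → Bool) → sum (χ ∘ b) ≡ 1 → ExactlyOne b
sum-χ≡1⇒ExactlyOne {suc n} b s with b zero in b₀
... | true  = zero , b₀ , λ
  { zero _ → refl
  ; (suc j) bⱼ →
      ⊥-elim (true≢false (trans (sym bⱼ) (χ≡0 (sum≡0 (χ ∘ b ∘ suc) (ℕ.suc-injective s) j)))) }
... | false with sum-χ≡1⇒ExactlyOne (b ∘ suc) s
...   | i , bᵢ , unique = suc i , bᵢ , λ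
  { zero b₀′ → ⊥-elim (true≢false (trans (sym b₀′) b₀))
  ; (suc j) bⱼ → cong suc (unique j bⱼ) }

ExactlyOne⇒sum-χ≡1 : ∀ {n} (b : Fin n → Bool) → ExactlyOne b → sum (χ ∘ b) ≡ 1
ExactlyOne⇒sum-χ≡1 b (i , bᵢ , unique) = trans (sum-single i off) (cong χ bᵢ)
  where
  off : ∀ j → j ≢ i → χ (b j) ≡ 0
  off j j≢i with b j in bⱼ
  ... | true  = ⊥-elim (j≢i (unique j bⱼ))
  ... | false = refl

sum-mono-≤ : ∀ {n} {f g : Fin n → ℕ} → (∀ i → f i ≤ g i) → sum f ≤ sum g
sum-mono-≤ {zero}  _   = z≤n
sum-mono-≤ {suc n} f≤g = +-mono-≤ (f≤g zero) (sum-mono-≤ (f≤g ∘ suc))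

sum-mono-< : ∀ {n} {f g : Fin n → ℕ} → (∀ i → f i ≤ g i) → ∀ i → f i < g i → sum f < sum g
sum-mono-< f≤g zero    f<g = +-mono-<-≤ f<g (sum-mono-≤ (f≤g ∘ suc))
sum-mono-< f≤g (suc i) f<g = +-mono-≤-< (f≤g zero) (sum-mono-< (f≤g ∘ suc) i f<g)

sum-↑ : ∀ m {n} (f : Fin (m + n) → ℕ) →
        sum f ≡ sum (λ i → f (i ↑ˡ n)) + sum (λ j → f (m ↑ʳ j))
sum-↑ zero    f = refl
sum-↑ (suc m) f =
  trans (cong (f zero +_) (sum-↑ m (f ∘ suc))) (sym (+-assoc (f zero) _ _))

sum-combine : ∀ m n (f : Fin (m * n) → ℕ) → sum f ≡ ∑[ i < m ] ∑[ j < n ] f (combine i j)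
sum-combine zero    n f = refl
sum-combine (suc m) n f =
  trans (sum-↑ n f) (cong (sum (λ j → f (j ↑ˡ m * n)) +_) (sum-combine m n (λ k → f (n ↑ʳ k))))

¬¬-∀-Fin : ∀ n {P : Fin n → Set} → (∀ i → ¬ ¬ P i) → ¬ ¬ (∀ i → P i)
¬¬-∀-Fin zero    _   ¬∀ = ¬∀ λ ()
¬¬-∀-Fin (suc n) ¬¬P ¬∀ =
  ¬¬P zero λ p₀ → ¬¬-∀-Fin n (¬¬P ∘ suc) λ ps → ¬∀ λ { zero → p₀ ; (suc i) → ps i }

record Finite (A : Set) : Set where
  field
    size        : ℕ
    enumeration : Fin size ↔ A

  element : Fin size → A
  element = Inverse.to enumeration

  index : A → Fin size
  index = Inverse.from enumeration

  element-index : ∀ a → element (index a) ≡ a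
  element-index = Inverse.strictlyInverseˡ enumeration

  index-element : ∀ i → index (element i) ≡ i
  index-element = Inverse.strictlyInverseʳ enumeration

  index-injective : ∀ {a b} → index a ≡ index b → a ≡ b
  index-injective {a} {b} eq =
    trans (sym (element-index a)) (trans (cong element eq) (element-index b))

  _≟_ : (a b : A) → Dec (a ≡ b)
  a ≟ b = map′ index-injective (cong index) (index a Fin.≟ index b)

open Finite using (size; enumeration; element; index; element-index; index-element; index-injective)

Fin-finite : ∀ n → Finite (Fin n)
Fin-finite n = record { size = n ; enumeration = mk↔ₛ′ id id (λ _ → refl) (λ _ → refl) }

_×-finite_ : {A B : Set} → Finite A → Finite B → Finite (A × B)
FA ×-finite FB = record
  { size        = size FA * size FB
  ; enumeration = mk↔ₛ′ to from to-from from-to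
  }
  where
  to : Fin (size FA * size FB) → _
  to k = map (element FA) (element FB) (remQuot (size FB) k)
  from : _ → Fin (size FA * size FB)
  from (a , b) = combine (index FA a) (index FB b)
  to-from : ∀ p → to (from p) ≡ p
  to-from (a , b) =
    trans (cong (map (element FA) (element FB)) (remQuot-combine (index FA a) (index FB b)))
          (cong₂ _,_ (element-index FA a) (element-index FB b))
  from-to : ∀ k → from (to k) ≡ k
  from-to k = trans (cong₂ combine (index-element FA _) (index-element FB _))
                    (combine-remQuot {size FA} (size FB) k)

module _ {A : Set} (F : Finite A) where

  ∑ : (A → ℕ) → ℕ
  ∑ f = sum (f ∘ element F)

  ∑-cong : ∀ {f g : A → ℕ} → (∀ a → f a ≡ g a) → ∑ f ≡ ∑ g
  ∑-cong f≗g = sum-cong-≗ (f≗g ∘ element F)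

  ∑-+ : ∀ (f g : A → ℕ) → ∑ (λ a → f a + g a) ≡ ∑ f + ∑ g
  ∑-+ f g = ∑-distrib-+ (f ∘ element F) (g ∘ element F)

  *-distribˡ-∑ : ∀ c (f : A → ℕ) → c * ∑ f ≡ ∑ (λ a → c * f a)
  *-distribˡ-∑ c f = *-distribˡ-sum c (f ∘ element F)

  ∑-zero : ∀ {f : A → ℕ} → (∀ a → f a ≡ 0) → ∑ f ≡ 0
  ∑-zero f≡0 = sum-zero (f≡0 ∘ element F)

  ∑-single : ∀ {f : A → ℕ} a → (∀ b → b ≢ a → f b ≡ 0) → ∑ f ≡ f a
  ∑-single {f} a f≡0 =
    trans (sum-single (index F a) λ j j≢ → f≡0 (element F j) λ e →
             j≢ (trans (sym (index-element F j)) (cong (index F) e)))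
          (cong f (element-index F a))

  ∑-mono-< : ∀ {f g : A → ℕ} → (∀ a → f a ≤ g a) → ∀ a → f a < g a → ∑ f < ∑ g
  ∑-mono-< {f} {g} f≤g a f<g = sum-mono-< (f≤g ∘ element F) (index F a)
    (subst (λ x → f x < g x) (sym (element-index F a)) f<g)

  ∑-permute : ∀ (π : A ↔ A) (f : A → ℕ) → ∑ f ≡ ∑ (f ∘ Inverse.to π)
  ∑-permute π f =
    trans (sum-permute {size F} {size F} (f ∘ element F)
                       (↔-sym (enumeration F) ↔-∘ (π ↔-∘ enumeration F)))
          (sum-cong-≗ λ i → cong f (element-index F (Inverse.to π (element F i))))

  δ : A → A → ℕ
  δ a b = χ (does (Finite._≟_ F a b))

  δ-refl : ∀ a → δ a a ≡ 1
  δ-refl a = cong χ (dec-true (Finite._≟_ F a a) refl)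

  δ-≢ : ∀ {a b} → a ≢ b → δ a b ≡ 0
  δ-≢ {a} {b} a≢b = cong χ (dec-false (Finite._≟_ F a b) a≢b)

  ∑-δ : ∀ a (f : A → ℕ) → ∑ (λ b → δ a b * f b) ≡ f a
  ∑-δ a f = trans (∑-single a λ b b≢a → cong (_* f b) (δ-≢ (b≢a ∘ sym)))
                  (trans (cong (_* f a) (δ-refl a)) (+-identityʳ (f a)))

  ¬¬-∀ : ∀ {P : A → Set} → (∀ a → ¬ ¬ P a) → ¬ ¬ (∀ a → P a)
  ¬¬-∀ {P} ¬¬P ¬∀ = ¬¬-∀-Fin (size F) (¬¬P ∘ element F)
    λ ∀P → ¬∀ λ a → subst P (element-index F a) (∀P (index F a))

  -- half counts each pair {a , p a} once, at its element of smaller index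
  ∑-even : (p : A → A) → (∀ a → p (p a) ≡ a) → (∀ a → p a ≢ a) →
           ∀ (g : A → ℕ) → (∀ a → g (p a) ≡ g a) → 2 ∣ ∑ g
  ∑-even p p-involutive p-fixpoint-free g g∘p =
    divides half (begin
      ∑ g                                                   ≡⟨ ∑-cong split ⟩
      ∑ (λ a → before a (p a) * g a + before (p a) a * g a) ≡⟨ ∑-+ (λ a → before a (p a) * g a)
                                                                   (λ a → before (p a) a * g a) ⟩
      half + ∑ (λ a → before (p a) a * g a)                 ≡⟨ cong (half +_) later-half ⟩
      half + half                                           ≡⟨ cong (half +_) (sym (+-identityʳ half)) ⟩
      2 * half                                              ≡⟨ *-comm 2 half ⟩
      half * 2                                              ∎)
    where
    open ≡-Reasoning
    before : A → A → ℕ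
    before a b = χ (does (index F a <? index F b))
    before-total : ∀ a b → a ≢ b → before a b + before b a ≡ 1
    before-total a b a≢b with <-cmp (index F a) (index F b)
    ... | tri< lt _ gt = cong₂ (λ x y → χ x + χ y) (dec-true (_ <? _) lt) (dec-false (_ <? _) gt)
    ... | tri> lt _ gt = cong₂ (λ x y → χ x + χ y) (dec-false (_ <? _) lt) (dec-true (_ <? _) gt)
    ... | tri≈ _ eq _ = ⊥-elim (a≢b (index-injective F eq))
    split : ∀ a → g a ≡ before a (p a) * g a + before (p a) a * g a
    split a = sym (trans (sym (*-distribʳ-+ (g a) (before a (p a)) _))
                (trans (cong (_* g a) (before-total a (p a) (p-fixpoint-free a ∘ sym)))
                       (*-identityˡ (g a))))
    half : ℕ
    half = ∑ (λ a → before a (p a) * g a)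
    later-half : ∑ (λ a → before (p a) a * g a) ≡ half
    later-half = trans (∑-permute (mk↔ₛ′ p p p-involutive p-involutive) (λ a → before (p a) a * g a))
                 (∑-cong λ a → cong₂ _*_ (cong (λ x → before x (p a)) (p-involutive a)) (g∘p a))

∑-comm : ∀ {A B : Set} (FA : Finite A) (FB : Finite B) (f : A → B → ℕ) →
         ∑ FA (λ a → ∑ FB (f a)) ≡ ∑ FB (λ b → ∑ FA (λ a → f a b))
∑-comm FA FB f = ℕSum.∑-comm (λ i j → f (element FA i) (element FB j))

∑-× : ∀ {A B : Set} (FA : Finite A) (FB : Finite B) (f : A × B → ℕ) →
      ∑ (FA ×-finite FB) f ≡ ∑ FA (λ a → ∑ FB (λ b → f (a , b)))
∑-× FA FB f = trans (sum-combine (size FA) (size FB) _)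
  (sum-cong-≗ λ i → sum-cong-≗ λ j →
     cong (f ∘ map (element FA) (element FB)) (remQuot-combine i j))

∑-image : ∀ {A : Set} (F : Finite A) {m} (φ : Fin m → A) → (∀ i j → φ i ≡ φ j → i ≡ j) →
          (g : A → ℕ) → (∀ a → g a ≡ 0 ⊎ ∃ λ i → φ i ≡ a) → ∑ F g ≡ sum (g ∘ φ)
∑-image F {m} φ φ-injective g support =
  trans (∑-cong F through-image)
    (trans (∑-comm F (Fin-finite m) (λ a i → δ F (φ i) a * g a))
           (sum-cong-≗ λ i → ∑-δ F (φ i) g))
  where
  through-image : ∀ a → g a ≡ ∑[ i < m ] (δ F (φ i) a * g a)
  through-image a with support a
  ... | inj₁ g≡0 =
    trans g≡0 (sym (sum-zero λ i → trans (cong (δ F (φ i) a *_) g≡0) (*-zeroʳ (δ F (φ i) a))))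
  ... | inj₂ (i , refl) = sym (trans
          (sum-single i λ j j≢i → cong (_* g (φ i)) (δ-≢ F (j≢i ∘ φ-injective j i)))
          (trans (cong (_* g (φ i)) (δ-refl F (φ i))) (+-identityʳ (g (φ i)))))

module _ {V : Set} {G : CubicRaw V} {P : V → Set} {E : Dart V → Set} where

  path-trans : ∀ {x y z} → Path G P E x y → Path G P E y z → Path G P E x z
  path-trans (here _)         q = q
  path-trans (step i px e p) q = step i px e (path-trans p q)

  path-source : ∀ {x y} → Path G P E x y → P x
  path-source (here px)       = px
  path-source (step _ px _ _) = px

  path-target : ∀ {x y} → Path G P E x y → P y
  path-target (here py)      = py
  path-target (step _ _ _ p) = path-target p

  edge-path : ∀ d → P (vtx d) → E d → P (vtx (partner G d)) →
              Path G P E (vtx d) (vtx (partner G d))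
  edge-path (x , i) px e py = step i px e (here py)

  path-sym : (∀ d → partner G (partner G d) ≡ d) → (∀ d → E d → E (partner G d)) →
             ∀ {x y} → Path G P E x y → Path G P E y x
  path-sym _   _   (here px) = here px
  path-sym inv E-sym {x} (step i px e p) =
    path-trans (path-sym inv E-sym p)
      (subst (Path G P E _) (cong vtx (inv (x , i)))
        (edge-path (partner G (x , i)) (path-source p) (E-sym (x , i) e)
          (subst P (sym (cong proj₁ (inv (x , i)))) px)))

path-map : ∀ {V : Set} {G : CubicRaw V} {P P' : V → Set} {E E' : Dart V → Set} →
           (∀ x → P x → P' x) → (∀ d → E d → E' d) →
           ∀ {x y} → Path G P E x y → Path G P' E' x y
path-map f g (here px)       = here (f _ px)
path-map f g (step i px e p) = step i (f _ px) (g _ e) (path-map f g p)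

punchIn-view : ∀ {n} (x₀ x : Fin (suc n)) → x ≡ x₀ ⊎ ∃ λ a → x ≡ punchIn x₀ a
punchIn-view x₀ x with x₀ Fin.≟ x
... | yes x₀≡x = inj₁ (sym x₀≡x)
... | no  x₀≢x = inj₂ (punchOut x₀≢x , sym (punchIn-punchOut x₀≢x))

punchOut-punchIn′ : ∀ {n} (x₀ : Fin (suc n)) {a} (x₀≢ : x₀ ≢ punchIn x₀ a) → punchOut x₀≢ ≡ a
punchOut-punchIn′ x₀ x₀≢ = trans (punchOut-cong x₀ refl) (punchOut-punchIn x₀)

third-index : ∀ (i j : Fin 3) → i ≢ j →
              Σ (Fin 3) λ l → l ≢ i × l ≢ j × (∀ k → k ≡ i ⊎ k ≡ j ⊎ k ≡ l)
third-index 0F 0F i≢j = ⊥-elim (i≢j refl)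
third-index 1F 1F i≢j = ⊥-elim (i≢j refl)
third-index 2F 2F i≢j = ⊥-elim (i≢j refl)
third-index 0F 1F _ = 2F , (λ ()) , (λ ()) ,
  λ { 0F → inj₁ refl ; 1F → inj₂ (inj₁ refl) ; 2F → inj₂ (inj₂ refl) }
third-index 0F 2F _ = 1F , (λ ()) , (λ ()) ,
  λ { 0F → inj₁ refl ; 1F → inj₂ (inj₂ refl) ; 2F → inj₂ (inj₁ refl) }
third-index 1F 0F _ = 2F , (λ ()) , (λ ()) ,
  λ { 0F → inj₂ (inj₁ refl) ; 1F → inj₁ refl ; 2F → inj₂ (inj₂ refl) }
third-index 1F 2F _ = 0F , (λ ()) , (λ ()) ,
  λ { 0F → inj₂ (inj₂ refl) ; 1F → inj₁ refl ; 2F → inj₂ (inj₁ refl) }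
third-index 2F 0F _ = 1F , (λ ()) , (λ ()) ,
  λ { 0F → inj₂ (inj₁ refl) ; 1F → inj₂ (inj₂ refl) ; 2F → inj₁ refl }
third-index 2F 1F _ = 0F , (λ ()) , (λ ()) ,
  λ { 0F → inj₂ (inj₂ refl) ; 1F → inj₂ (inj₁ refl) ; 2F → inj₁ refl }

Fin3-connected : {R : Fin 3 → Fin 3 → Set} →
                 (∀ i → R i i) → (∀ {i j} → R i j → R j i) → (∀ {i j k} → R i j → R j k → R i k) →
                 (∀ i → Σ (Fin 3) λ j → j ≢ i × R i j) → ∀ i j → R i j
Fin3-connected {R} R-refl R-sym R-trans linked i j = R-trans (R-sym (from-0 i)) (from-0 j)
  where
  linked-12 : (Σ (Fin 3) λ i → i ≢ 0F × R 0F i) → R 0F 1F × R 0F 2F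
  linked-12 (1F , _ , R01) with linked 2F
  ... | 0F , _ , R20 = R01 , R-sym R20
  ... | 1F , _ , R21 = R01 , R-trans R01 (R-sym R21)
  ... | 2F , 2≢2 , _ = ⊥-elim (2≢2 refl)
  linked-12 (2F , _ , R02) with linked 1F
  ... | 0F , _ , R10 = R-sym R10 , R02
  ... | 1F , 1≢1 , _ = ⊥-elim (1≢1 refl)
  ... | 2F , _ , R12 = R-trans R02 (R-sym R12) , R02
  linked-12 (0F , 0≢0 , _) = ⊥-elim (0≢0 refl)
  from-0 : ∀ i → R 0F i
  from-0 0F = R-refl 0F
  from-0 1F = proj₁ (linked-12 (linked 0F))
  from-0 2F = proj₂ (linked-12 (linked 0F))

other : Fin 3 → Fin 3
other 0F      = 1F
other (suc _) = 0F

other-≢ : ∀ i → other i ≢ i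
other-≢ 0F      ()
other-≢ (suc _) ()

module VertexDeletion {n : ℕ} (X : CubicRaw (Fin (suc n))) (x₀ : Fin (suc n))
                      (cubic : IsCubic X) (2-connected : TwoConnected X) where

  private
    p : Dart (Fin (suc n)) → Dart (Fin (suc n))
    p = partner X

  involutive : ∀ d → p (p d) ≡ d
  involutive = proj₁ cubic

  partner-swap : ∀ {d e} → p d ≡ e → p e ≡ d
  partner-swap {d} p-d = trans (cong p (sym p-d)) (involutive d)

  ι : Fin n → Fin (suc n)
  ι = punchIn x₀

  lift : Dart (Fin n) → Dart (Fin (suc n))
  lift = map₁ ι

  lift-injective : ∀ {d e} → lift d ≡ lift e → d ≡ e
  lift-injective {a , j} {a' , j'} eq =
    cong₂ _,_ (punchIn-injective x₀ a a' (cong proj₁ eq)) (cong proj₂ eq)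

  Kept : Fin (suc n) → Set
  Kept y = y ≢ x₀

  stuck-at-x₀ : ∀ l → (∀ k → k ≢ l → vtx (p (x₀ , k)) ≡ x₀) →
                ∀ {z y} → Path X (λ _ → ⊤) (AvoidEdge X (x₀ , l)) z y → z ≡ x₀ → y ≡ x₀
  stuck-at-x₀ l stuck (here _) z≡x₀ = z≡x₀
  stuck-at-x₀ l stuck (step k _ (≢l , _) rest) refl =
    stuck-at-x₀ l stuck rest (stuck k (≢l ∘ cong (x₀ ,_)))

  -- A loop at x₀ would leave its third edge a bridge.
  no-loop-at : ∀ i j → p (x₀ , i) ≡ (x₀ , j) → ⊥
  no-loop-at i j p-i = third-edge-bridge (third-index i j i≢j)
    where
    i≢j : i ≢ j
    i≢j refl = proj₂ cubic (x₀ , i) p-i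
    third-edge-bridge : (Σ (Fin 3) λ l → l ≢ i × l ≢ j × (∀ k → k ≡ i ⊎ k ≡ j ⊎ k ≡ l)) → ⊥
    third-edge-bridge (l , l≢i , l≢j , cases) = back-at-x₀ (cases m)
      where
      stuck : ∀ k → k ≢ l → vtx (p (x₀ , k)) ≡ x₀
      stuck k k≢l with cases k
      ... | inj₁ refl        = cong vtx p-i
      ... | inj₂ (inj₁ refl) = cong vtx (partner-swap p-i)
      ... | inj₂ (inj₂ k≡l)  = ⊥-elim (k≢l k≡l)
      m : Fin 3
      m = proj₂ (p (x₀ , l))
      p-l : p (x₀ , l) ≡ (x₀ , m)
      p-l = cong (_, m) (stuck-at-x₀ l stuck (proj₂ 2-connected (x₀ , l) x₀ _) refl)
      back-at-x₀ : m ≡ i ⊎ m ≡ j ⊎ m ≡ l → ⊥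
      back-at-x₀ (inj₁ m≡i) =
        l≢j (cong proj₂ (trans (sym (subst (λ k → p (x₀ , k) ≡ (x₀ , l)) m≡i (partner-swap p-l))) p-i))
      back-at-x₀ (inj₂ (inj₁ m≡j)) =
        l≢i (cong proj₂ (trans (sym (subst (λ k → p (x₀ , k) ≡ (x₀ , l)) m≡j (partner-swap p-l)))
                               (partner-swap p-i)))
      back-at-x₀ (inj₂ (inj₂ m≡l)) = proj₂ cubic (x₀ , l) (trans p-l (cong (x₀ ,_) m≡l))

  no-loop : ∀ i → x₀ ≢ vtx (p (x₀ , i))
  no-loop i x₀≡ = no-loop-at i _ (cong (_, proj₂ (p (x₀ , i))) (sym x₀≡))

  -- stub i is the dart of X - x₀ that the edge at (x₀ , i) joined to x₀
  stub : Fin 3 → Dart (Fin n)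
  stub i = punchOut (no-loop i) , proj₂ (p (x₀ , i))

  neighbour : Fin 3 → Fin n
  neighbour = proj₁ ∘ stub

  partner-x₀ : ∀ i → p (x₀ , i) ≡ lift (stub i)
  partner-x₀ i = cong (_, proj₂ (p (x₀ , i))) (sym (punchIn-punchOut (no-loop i)))

  partner-stub : ∀ i → p (lift (stub i)) ≡ (x₀ , i)
  partner-stub i = partner-swap (partner-x₀ i)

  stub-unique : ∀ {d i} → p (lift d) ≡ (x₀ , i) → d ≡ stub i
  stub-unique {i = i} p-d = lift-injective (trans (sym (partner-swap p-d)) (partner-x₀ i))

  stub-injective : ∀ {i i'} → stub i ≡ stub i' → i ≡ i'
  stub-injective {i} {i'} eq =
    cong proj₂ (trans (sym (partner-stub i)) (trans (cong (p ∘ lift) eq) (partner-stub i')))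

  stub-partner-not-inside : ∀ {i e} → p (lift (stub i)) ≢ lift e
  stub-partner-not-inside {i} {e} eq =
    punchInᵢ≢i x₀ (proj₁ e) (sym (cong vtx (trans (sym (partner-stub i)) eq)))

  data PartnerView (d : Dart (Fin n)) : Set where
    inside : ∀ e → p (lift d) ≡ lift e → PartnerView d
    cut    : ∀ i → d ≡ stub i → PartnerView d

  partner-view : ∀ d → PartnerView d
  partner-view d with punchIn-view x₀ (vtx (p (lift d)))
  ... | inj₁ at-x₀      = cut _ (stub-unique (cong (_, proj₂ (p (lift d))) at-x₀))
  ... | inj₂ (a , at-a) = inside (a , _) (cong (_, proj₂ (p (lift d))) at-a)

  walk-to-stub : ∀ {E : Dart (Fin (suc n)) → Set} {y z} → Path X (λ _ → ⊤) E y z → z ≡ x₀ →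
                 ∀ a → y ≡ ι a →
                 Σ (Fin 3) λ i → Path X Kept E (ι a) (ι (neighbour i)) × E (lift (stub i))
  walk-to-stub (here _) z≡x₀ a refl = ⊥-elim (punchInᵢ≢i x₀ a z≡x₀)
  walk-to-stub {E} (step k _ e rest) z≡x₀ a refl with partner-view (a , k)
  ... | cut i refl = i , here (punchInᵢ≢i x₀ a) , e
  ... | inside (a' , _) p-d with walk-to-stub rest z≡x₀ a' (cong vtx p-d)
  ...   | i , walk , e-i =
    i , step k (punchInᵢ≢i x₀ a) e (subst (λ y → Path X Kept E y _) (sym (cong vtx p-d)) walk) , e-i

  stub-linked : ∀ i →
    Σ (Fin 3) λ i' → i' ≢ i × Path X Kept (λ _ → ⊤) (ι (neighbour i)) (ι (neighbour i'))
  stub-linked i with walk-to-stub (proj₂ 2-connected (x₀ , i) (ι (neighbour i)) x₀) refl _ refl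
  ... | i' , walk , (_ , ≢p-i) =
    i' , (λ { refl → ≢p-i (sym (partner-x₀ i)) }) , path-map (λ _ k → k) _ walk

  walk-sym : ∀ {y z} → Path X Kept (λ _ → ⊤) y z → Path X Kept (λ _ → ⊤) z y
  walk-sym = path-sym involutive λ _ _ → tt

  walk-from-stub : ∀ a → Σ (Fin 3) λ i → Path X Kept (λ _ → ⊤) (ι a) (ι (neighbour i))
  walk-from-stub a with walk-to-stub (proj₁ 2-connected (ι a) x₀) refl a refl
  ... | i , walk , _ = i , walk

  deletion-connected : ∀ a a' → Path X Kept (λ _ → ⊤) (ι a) (ι a')
  deletion-connected a a' with walk-from-stub a | walk-from-stub a'
  ... | i , walk | i' , walk' = path-trans walk (path-trans (stubs-linked i i') (walk-sym walk'))
    where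
    stubs-linked : ∀ i i' → Path X Kept (λ _ → ⊤) (ι (neighbour i)) (ι (neighbour i'))
    stubs-linked =
      Fin3-connected (λ i → here (punchInᵢ≢i x₀ (neighbour i))) walk-sym path-trans stub-linked

  module Embedding {V : Set} (G : CubicRaw V) (emb : Fin n → V)
                   (emb-injective : ∀ {a a'} → emb a ≡ emb a' → a ≡ a')
                   (emb-partner : ∀ {d e} → p (lift d) ≡ lift e →
                                  partner G (map₁ emb d) ≡ map₁ emb e) where

    embed : Dart (Fin n) → Dart V
    embed = map₁ emb

    embed-injective : ∀ {d d'} → embed d ≡ embed d' → d ≡ d'
    embed-injective eq = cong₂ _,_ (emb-injective (cong proj₁ eq)) (cong proj₂ eq)

    embed-walk : ∀ {EX : Dart (Fin (suc n)) → Set} {EG : Dart V → Set} {P : V → Set} →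
                 (∀ a → P (emb a)) → (∀ d e → p (lift d) ≡ lift e → EX (lift d) → EG (embed d)) →
                 ∀ {y z} → Path X Kept EX y z →
                 ∀ a a' → y ≡ ι a → z ≡ ι a' → Path G P EG (emb a) (emb a')
    embed-walk P-emb E-emb (here _) a a' refl z≡ =
      subst (λ b → Path G _ _ (emb a) (emb b)) (punchIn-injective x₀ a a' z≡) (here (P-emb a))
    embed-walk P-emb E-emb (step k _ e rest) a a' refl z≡ with partner-view (a , k)
    ... | cut i refl = ⊥-elim (path-source rest (cong vtx (partner-stub i)))
    ... | inside e' p-d =
      step k (P-emb a) (E-emb (a , k) e' p-d e)
        (subst (λ y → Path G _ _ y (emb a')) (sym (cong vtx (emb-partner p-d)))
          (embed-walk P-emb E-emb rest (proj₁ e') a' (cong vtx p-d) z≡))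

    embedded-connected : ∀ {P : V → Set} {E : Dart V → Set} → (∀ a → P (emb a)) →
                         (∀ d e → p (lift d) ≡ lift e → E (embed d)) →
                         ∀ a a' → Path G P E (emb a) (emb a')
    embedded-connected P-emb E-emb a a' =
      embed-walk P-emb (λ d e p-d _ → E-emb d e p-d) (deletion-connected a a') a a' refl refl

    avoid-embed : ∀ {d e} → p (lift d) ≡ lift e →
                  ∀ d' → AvoidEdge X (lift d) (lift d') → AvoidEdge G (embed d) (embed d')
    avoid-embed {d} {e} p-d d' (≢d , ≢p-d) =
        (λ eq → ≢d (cong lift (embed-injective eq)))
      , (λ eq → ≢p-d (trans (cong lift (embed-injective (trans eq (emb-partner p-d)))) (sym p-d)))

    walk-to-stub-avoiding : ∀ {d e} → p (lift d) ≡ lift e → ∀ a →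
      Σ (Fin 3) λ i → Path G (λ _ → ⊤) (AvoidEdge G (embed d)) (emb a) (emb (neighbour i))
                      × AvoidEdge G (embed d) (embed (stub i))
    walk-to-stub-avoiding {d} p-d a
      with walk-to-stub (proj₂ 2-connected (lift d) (ι a) x₀) refl a refl
    ... | i , walk , avoids =
      i , embed-walk (λ _ → tt) (λ d' _ _ → avoid-embed p-d d') walk a (neighbour i) refl refl
        , avoid-embed p-d (stub i) avoids

module StubGluing {V : Set} (G : CubicRaw V) (G-involutive : ∀ d → partner G (partner G d) ≡ d)
  {h k : ℕ} (H : CubicRaw (Fin (suc h))) (u : Fin (suc h)) (cubicH : IsCubic H) (2-connH : TwoConnected H)
  (K : CubicRaw (Fin (suc k))) (v : Fin (suc k)) (cubicK : IsCubic K) (2-connK : TwoConnected K)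
  (ε₁ : Fin h → V) (ε₂ : Fin k → V)
  (ε₁-injective : ∀ {a a'} → ε₁ a ≡ ε₁ a' → a ≡ a')
  (ε₂-injective : ∀ {b b'} → ε₂ b ≡ ε₂ b' → b ≡ b')
  (ε₁≢ε₂ : ∀ {a b} → ε₁ a ≢ ε₂ b)
  (covers : ∀ x → (∃ λ a → x ≡ ε₁ a) ⊎ (∃ λ b → x ≡ ε₂ b))
  (ε₁-partner : ∀ {d e : Dart (Fin h)} → partner H (map₁ (punchIn u) d) ≡ map₁ (punchIn u) e →
                partner G (map₁ ε₁ d) ≡ map₁ ε₁ e)
  (ε₂-partner : ∀ {d e : Dart (Fin k)} → partner K (map₁ (punchIn v) d) ≡ map₁ (punchIn v) e →
                partner G (map₁ ε₂ d) ≡ map₁ ε₂ e)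
  (τ : Fin 3 → Fin 3)
  (cross : ∀ i → partner G (map₁ ε₁ (VertexDeletion.stub H u cubicH 2-connH i))
                 ≡ map₁ ε₂ (VertexDeletion.stub K v cubicK 2-connK (τ i)))
  where

  module H∖u = VertexDeletion H u cubicH 2-connH
  module K∖v = VertexDeletion K v cubicK 2-connK

  module side₁ = H∖u.Embedding G ε₁ ε₁-injective ε₁-partner
  module side₂ = K∖v.Embedding G ε₂ ε₂-injective ε₂-partner

  crossing : ∀ {E : Dart V → Set} i → E (map₁ ε₁ (H∖u.stub i)) →
             Path G (λ _ → ⊤) E (ε₁ (H∖u.neighbour i)) (ε₂ (K∖v.neighbour (τ i)))
  crossing {E} i e = subst (Path G _ E _) (cong vtx (cross i)) (edge-path _ tt e tt)

  connected-if-sides-linked : ∀ {E : Dart V → Set} → (∀ d → E d → E (partner G d)) →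
    (∀ a b → Path G (λ _ → ⊤) E (ε₁ a) (ε₂ b)) → ∀ x y → Path G (λ _ → ⊤) E x y
  connected-if-sides-linked {E} E-sym linked x y with covers x | covers y
  ... | inj₁ (a , refl) | inj₁ (a' , refl) =
    path-trans (linked a b₀) (path-sym G-involutive E-sym (linked a' b₀))
    where
    b₀ : Fin k
    b₀ = K∖v.neighbour zero
  ... | inj₁ (a , refl) | inj₂ (b , refl)  = linked a b
  ... | inj₂ (b , refl) | inj₁ (a , refl)  = path-sym G-involutive E-sym (linked a b)
  ... | inj₂ (b , refl) | inj₂ (b' , refl) =
    path-trans (path-sym G-involutive E-sym (linked a₀ b)) (linked a₀ b')
    where
    a₀ : Fin h
    a₀ = H∖u.neighbour zero

  avoid-sym : ∀ D e → AvoidEdge G D e → AvoidEdge G D (partner G e)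
  avoid-sym D e (≢D , ≢pD) =
      (λ q → ≢pD (trans (sym (G-involutive e)) (cong (partner G) q)))
    , (λ q → ≢D (trans (sym (G-involutive e)) (trans (cong (partner G) q) (G-involutive D))))

  inner-edge-links-sides : ∀ {d e} → partner H (H∖u.lift d) ≡ H∖u.lift e →
    ∀ a b → Path G (λ _ → ⊤) (AvoidEdge G (map₁ ε₁ d)) (ε₁ a) (ε₂ b)
  inner-edge-links-sides {d} p-d a b with side₁.walk-to-stub-avoiding p-d a
  ... | i , walk , avoids = path-trans walk (path-trans (crossing i avoids) (side₂-connected _ b))
    where
    side₂-connected : ∀ b b' → Path G (λ _ → ⊤) (AvoidEdge G (map₁ ε₁ d)) (ε₂ b) (ε₂ b')
    side₂-connected = side₂.embedded-connected (λ _ → tt) λ _ _ _ →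
        (λ q → ε₁≢ε₂ (sym (cong proj₁ q)))
      , (λ q → ε₁≢ε₂ (sym (cong proj₁ (trans q (ε₁-partner p-d)))))

  cross-edge-links-sides : ∀ i₀ a b →
    Path G (λ _ → ⊤) (AvoidEdge G (map₁ ε₁ (H∖u.stub i₀))) (ε₁ a) (ε₂ b)
  cross-edge-links-sides i₀ a b =
    path-trans (side₁-connected a (H∖u.neighbour i₁))
      (path-trans (crossing i₁ avoids-i₁) (side₂-connected (K∖v.neighbour (τ i₁)) b))
    where
    i₁ : Fin 3
    i₁ = other i₀
    avoids-i₁ : AvoidEdge G (map₁ ε₁ (H∖u.stub i₀)) (map₁ ε₁ (H∖u.stub i₁))
    avoids-i₁ = (λ q → other-≢ i₀ (H∖u.stub-injective (side₁.embed-injective q)))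
              , (λ q → ε₁≢ε₂ (cong proj₁ (trans q (cross i₀))))
    side₁-connected : ∀ a a' →
                      Path G (λ _ → ⊤) (AvoidEdge G (map₁ ε₁ (H∖u.stub i₀))) (ε₁ a) (ε₁ a')
    side₁-connected = side₁.embedded-connected (λ _ → tt) λ d' e' p-d' →
        (λ q → H∖u.stub-partner-not-inside
                 (subst (λ x → partner H (H∖u.lift x) ≡ _) (side₁.embed-injective q) p-d'))
      , (λ q → ε₁≢ε₂ (cong proj₁ (trans q (cross i₀))))
    side₂-connected : ∀ b b' →
                      Path G (λ _ → ⊤) (AvoidEdge G (map₁ ε₁ (H∖u.stub i₀))) (ε₂ b) (ε₂ b')
    side₂-connected = side₂.embedded-connected (λ _ → tt) λ d' e' p-d' →
        (λ q → ε₁≢ε₂ (sym (cong proj₁ q)))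
      , (λ q → K∖v.stub-partner-not-inside
                 (subst (λ x → partner K (K∖v.lift x) ≡ _)
                        (side₂.embed-injective (trans q (cross i₀))) p-d'))

  connected : Connected G
  connected = connected-if-sides-linked (λ _ _ → tt) λ a b →
    path-map (λ _ _ → tt) (λ _ _ → tt) (cross-edge-links-sides zero a b)

  inner-edge-not-bridge : ∀ {d e} → partner H (H∖u.lift d) ≡ H∖u.lift e →
    ∀ x y → Path G (λ _ → ⊤) (AvoidEdge G (map₁ ε₁ d)) x y
  inner-edge-not-bridge p-d = connected-if-sides-linked (avoid-sym _) (inner-edge-links-sides p-d)

  cross-edge-not-bridge : ∀ i → ∀ x y → Path G (λ _ → ⊤) (AvoidEdge G (map₁ ε₁ (H∖u.stub i))) x y
  cross-edge-not-bridge i = connected-if-sides-linked (avoid-sym _) (cross-edge-links-sides i)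

IsComponentCut : {V : Set} → CubicRaw V → (V → Bool) → V → (Fin 3 → Dart V) → Set
IsComponentCut G U x f =
  (∀ i j → f i ≡ f j → i ≡ j) ×
  (∀ i → InComp G U x (vtx (f i)) × (U (vtx (partner G (f i))) ≡ true)) ×
  (∀ d → InComp G U x (vtx d) → U (vtx (partner G d)) ≡ true → Σ (Fin 3) λ i → f i ≡ d)

2∤3 : ¬ 2 ∣ 3
2∤3 (divides (suc (suc _)) ())

module ComponentCuts
  {V : Set} (finite : Finite V) (G : CubicRaw V) (cubic : IsCubic G)
  (U : V → Bool) (contraction : ContractionBipartiteCubic G U)
  (component? : ∀ x y → Dec (InComp G U x y)) where

  private
    p : Dart V → Dart V
    p = partner G
    involutive : ∀ d → p (p d) ≡ d
    involutive = proj₁ cubic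
    darts : Finite (Dart V)
    darts = finite ×-finite Fin-finite 3
    ∑ᵛ : (V → ℕ) → ℕ
    ∑ᵛ = ∑ finite
    ∑ᵈ : (Dart V → ℕ) → ℕ
    ∑ᵈ = ∑ darts

  1ᵈ : Dart V → ℕ
  1ᵈ _ = 1

  cut-of : ∀ x → U x ≡ false → Σ (Fin 3 → Dart V) (IsComponentCut G U x)
  cut-of = proj₂ (proj₂ contraction)

  component-sym : ∀ {x y} → InComp G U x y → InComp G U y x
  component-sym = path-sym involutive λ _ _ → tt

  same : V → V → ℕ
  same x y = χ (does (component? x y))

  same-yes : ∀ {x y} → InComp G U x y → same x y ≡ 1
  same-yes {x} {y} c = cong χ (dec-true (component? x y) c)

  same-no : ∀ {x y} → ¬ InComp G U x y → same x y ≡ 0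
  same-no {x} {y} ¬c = cong χ (dec-false (component? x y) ¬c)

  same-U : ∀ {x y} → U y ≡ true → same x y ≡ 0
  same-U Uy = same-no λ c → true≢false (trans (sym Uy) (path-target c))

  same-shift : ∀ {x y} → InComp G U x y → ∀ z → same y z ≡ same x z
  same-shift {x} {y} c z with component? y z
  ... | yes c' = sym (same-yes (path-trans c c'))
  ... | no ¬c' = sym (same-no λ c'' → ¬c' (path-trans (component-sym c) c''))

  inU : V → ℕ
  inU y = χ (U y)

  leaving : V → Dart V → ℕ
  leaving x d = same x (vtx d) * inU (vtx (p d))

  internal : V → Dart V → ℕ
  internal x d = same x (vtx d) * same x (vtx (p d))

  same-split : ∀ x d → same x (vtx d) ≡ internal x d + leaving x d
  same-split x d with component? x (vtx d)
  ... | no _ = refl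
  ... | yes c with U (vtx (p d)) in Upd
  ...   | true  rewrite same-U {x} Upd = refl
  ...   | false rewrite same-yes (path-trans c (edge-path d (path-target c) tt Upd)) = refl

  ∑-leaving : ∀ {x f} → IsComponentCut G U x f → ∀ (w : Dart V → ℕ) →
              ∑ᵈ (λ d → leaving x d * w d) ≡ ∑[ i < 3 ] w (f i)
  ∑-leaving {x} {f} (f-injective , f-leaves , f-complete) w =
    trans (∑-image darts f f-injective (λ d → leaving x d * w d) support)
          (sum-cong-≗ weight-one)
    where
    weight-one : ∀ i → leaving x (f i) * w (f i) ≡ w (f i)
    weight-one i rewrite same-yes (proj₁ (f-leaves i)) | proj₂ (f-leaves i) = +-identityʳ (w (f i))
    support : ∀ d → leaving x d * w d ≡ 0 ⊎ ∃ λ i → f i ≡ d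
    support d with component? x (vtx d) | U (vtx (p d)) in Upd
    ... | yes c | true  = inj₂ (f-complete d c Upd)
    ... | yes _ | false = inj₁ refl
    ... | no _  | _     = inj₁ refl

  ∑ᵈ-at-vertices : ∀ (c : V → ℕ) (w : Dart V → ℕ) →
                   ∑ᵈ (λ d → c (vtx d) * w d) ≡ ∑ᵛ (λ y → c y * ∑[ i < 3 ] w (y , i))
  ∑ᵈ-at-vertices c w = trans (∑-× finite (Fin-finite 3) (λ d → c (vtx d) * w d))
    (∑-cong finite λ y → sym (*-distribˡ-sum (c y) (λ i → w (y , i))))

  ∑-split : ∀ x (w : Dart V → ℕ) → ∑ᵈ (λ d → same x (vtx d) * w d) ≡
                    ∑ᵈ (λ d → internal x d * w d) + ∑ᵈ (λ d → leaving x d * w d)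
  ∑-split x w =
    trans (∑-cong darts λ d → trans (cong (_* w d) (same-split x d))
                                    (*-distribʳ-+ (w d) (internal x d) (leaving x d)))
          (∑-+ darts (λ d → internal x d * w d) (λ d → leaving x d * w d))

  internal-even : ∀ x (w : Dart V → ℕ) → (∀ d → w (p d) ≡ w d) →
                  2 ∣ ∑ᵈ (λ d → internal x d * w d)
  internal-even x w w-sym = ∑-even darts p involutive (proj₂ cubic) (λ d → internal x d * w d) λ d →
    cong₂ _*_ (trans (cong (λ e → same x (vtx (p d)) * same x (vtx e)) (involutive d))
                     (*-comm (same x (vtx (p d))) (same x (vtx d))))
              (w-sym d)

  -- 3|C| = 2·(edges inside C) + 3
  component-size-odd : ∀ x → U x ≡ false → ¬ 2 ∣ ∑ᵛ (same x)
  component-size-odd x Ux 2∣size = 2∤3 (∣m+n∣m⇒∣n (subst (2 ∣_) three-sizes (∣n⇒∣m*n 3 2∣size))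
                                                  (internal-even x 1ᵈ λ _ → refl))
    where
    three-sizes : 3 * ∑ᵛ (same x) ≡ ∑ᵈ (λ d → internal x d * 1) + 3
    three-sizes = begin
      3 * ∑ᵛ (same x)                ≡⟨ *-distribˡ-∑ finite 3 (same x) ⟩
      ∑ᵛ (λ y → 3 * same x y)        ≡⟨ ∑-cong finite (λ y → *-comm 3 (same x y)) ⟩
      ∑ᵛ (λ y → same x y * 3)        ≡⟨ ∑ᵈ-at-vertices (same x) 1ᵈ ⟨
      ∑ᵈ (λ d → same x (vtx d) * 1)  ≡⟨ ∑-split x 1ᵈ ⟩
      ∑ᵈ (λ d → internal x d * 1) + ∑ᵈ (λ d → leaving x d * 1)
        ≡⟨ cong (∑ᵈ (λ d → internal x d * 1) +_) (∑-leaving (proj₂ (cut-of x Ux)) 1ᵈ) ⟩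
      ∑ᵈ (λ d → internal x d * 1) + 3 ∎
      where open ≡-Reasoning

  boundary : Dart V → ℕ
  boundary d = χ (not (U (vtx d))) * inU (vtx (p d))

  boundary-partner : ∀ d → boundary (p d) ≡ inU (vtx d)
  boundary-partner d rewrite involutive d with U (vtx d) in Ud
  ... | false = *-zeroʳ (χ (not (U (vtx (p d)))))
  ... | true with U (vtx (p d)) in Upd
  ...   | true  = ⊥-elim (proj₁ contraction d Ud Upd)
  ...   | false = refl

  boundary-cut : ∀ {d} → U (vtx d) ≡ false → U (vtx (p d)) ≡ true → boundary d ≡ 1
  boundary-cut Ud Upd rewrite Ud | Upd = refl

  ∑-boundary : ∀ (w : Dart V → ℕ) → (∀ d → w (p d) ≡ w d) →
               ∑ᵈ (λ d → boundary d * w d) ≡ ∑ᵛ (λ y → inU y * ∑[ i < 3 ] w (y , i))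
  ∑-boundary w w-sym =
    trans (∑-permute darts (mk↔ₛ′ p p involutive involutive) (λ d → boundary d * w d))
          (trans (∑-cong darts λ d → cong₂ _*_ (boundary-partner d) (w-sym d)) (∑ᵈ-at-vertices inU w))

  boundary-leaving-swap : ∀ (w : Dart V → ℕ) d e →
    boundary d * (leaving (vtx d) e * w e) ≡ leaving (vtx e) d * (boundary e * w e)
  boundary-leaving-swap w d e with component? (vtx e) (vtx d)
  ... | yes c rewrite same-yes (component-sym c) | path-source c | path-target c = refl
  ... | no ¬c rewrite same-no (¬c ∘ component-sym) = *-zeroʳ (boundary d)

  ∑-leaving-boundary : ∀ (w : Dart V → ℕ) e →
    ∑ᵈ (λ d → leaving (vtx e) d * (boundary e * w e)) ≡ 3 * (boundary e * w e)
  ∑-leaving-boundary w e with U (vtx e) in Ue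
  ... | true  = ∑-zero darts λ d → *-zeroʳ (leaving (vtx e) d)
  ... | false = ∑-leaving (proj₂ (cut-of (vtx e) Ue)) (λ _ → 1 * inU (vtx (p e)) * w e)

  module _ (M : Dart V → Bool) (perfect : PerfectMatching G M) where

    private
      m : Dart V → ℕ
      m d = χ (M d)

      m-sym : ∀ d → m (p d) ≡ m d
      m-sym d = cong χ (proj₁ perfect d)

      m-vertex : ∀ y → ∑[ i < 3 ] m (y , i) ≡ 1
      m-vertex y = ExactlyOne⇒sum-χ≡1 (λ i → M (y , i)) (proj₂ perfect y)

    meets : V → ℕ
    meets x = ∑ᵈ (λ d → leaving x d * m d)

    meets-shift : ∀ {x y} → InComp G U x y → meets y ≡ meets x
    meets-shift c = ∑-cong darts λ d → cong (λ s → s * inU (vtx (p d)) * m d) (same-shift c (vtx d))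

    meets-positive : ∀ x → U x ≡ false → 1 ≤ meets x
    meets-positive x Ux = n≢0⇒n>0 λ meets≡0 → component-size-odd x Ux
      (subst (2 ∣_) (sym (trans component-matched (∑-split x m)))
        (∣m∣n⇒∣m+n (internal-even x m m-sym) (subst (2 ∣_) (sym meets≡0) (2 ∣0))))
      where
      component-matched : ∑ᵛ (same x) ≡ ∑ᵈ (λ d → same x (vtx d) * m d)
      component-matched =
        trans (∑-cong finite λ y → sym (trans (cong (same x y *_) (m-vertex y)) (*-identityʳ (same x y))))
              (sym (∑ᵈ-at-vertices (same x) m))

    boundary-matched : ∑ᵈ (λ d → boundary d * 1) ≡ 3 * ∑ᵈ (λ d → boundary d * m d)
    boundary-matched = begin
      ∑ᵈ (λ d → boundary d * 1)                   ≡⟨ ∑-boundary 1ᵈ (λ _ → refl) ⟩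
      ∑ᵛ (λ y → inU y * 3)                        ≡⟨ ∑-cong finite (λ y → *-comm (inU y) 3) ⟩
      ∑ᵛ (λ y → 3 * inU y)                        ≡⟨ *-distribˡ-∑ finite 3 inU ⟨
      3 * ∑ᵛ inU                                  ≡⟨ cong (3 *_) (∑-cong finite λ y → sym
                                                       (trans (cong (inU y *_) (m-vertex y)) (*-identityʳ (inU y)))) ⟩
      3 * ∑ᵛ (λ y → inU y * ∑[ i < 3 ] m (y , i)) ≡⟨ cong (3 *_) (∑-boundary m m-sym) ⟨
      3 * ∑ᵈ (λ d → boundary d * m d)             ∎
      where open ≡-Reasoning

    boundary-meets : ∑ᵈ (λ d → boundary d * meets (vtx d)) ≡ 3 * ∑ᵈ (λ e → boundary e * m e)
    boundary-meets = begin
      ∑ᵈ (λ d → boundary d * meets (vtx d))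
        ≡⟨ ∑-cong darts (λ d → *-distribˡ-∑ darts (boundary d) (λ e → leaving (vtx d) e * m e)) ⟩
      ∑ᵈ (λ d → ∑ᵈ (λ e → boundary d * (leaving (vtx d) e * m e)))
        ≡⟨ ∑-comm darts darts (λ d e → boundary d * (leaving (vtx d) e * m e)) ⟩
      ∑ᵈ (λ e → ∑ᵈ (λ d → boundary d * (leaving (vtx d) e * m e)))
        ≡⟨ ∑-cong darts (λ e → ∑-cong darts λ d → boundary-leaving-swap m d e) ⟩
      ∑ᵈ (λ e → ∑ᵈ (λ d → leaving (vtx e) d * (boundary e * m e)))
        ≡⟨ ∑-cong darts (∑-leaving-boundary m) ⟩
      ∑ᵈ (λ e → 3 * (boundary e * m e))
        ≡⟨ *-distribˡ-∑ darts 3 (λ e → boundary e * m e) ⟨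
      3 * ∑ᵈ (λ e → boundary e * m e)
        ∎
      where open ≡-Reasoning

    -- The boundary darts have the same total weight 3 |U| under the weights 1 and meets (vtx d),
    -- and meets (vtx d) ≥ 1 for each of them, so no component meets M more than once.
    meets-once : ∀ x → U x ≡ false → meets x ≡ 1
    meets-once x Ux =
      ≤-antisym (≮⇒≥ λ 1<meets → <-irrefl refl (more-than-itself 1<meets)) (meets-positive x Ux)
      where
      d₀ : Dart V
      d₀ = proj₁ (cut-of x Ux) zero
      d₀-leaves : InComp G U x (vtx d₀) × (U (vtx (p d₀)) ≡ true)
      d₀-leaves = proj₁ (proj₂ (proj₂ (cut-of x Ux))) zero
      pointwise : ∀ d → boundary d * 1 ≤ boundary d * meets (vtx d)
      pointwise d with U (vtx d) in Ud
      ... | true  = z≤n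
      ... | false = *-monoʳ-≤ (1 * inU (vtx (p d))) (meets-positive (vtx d) Ud)
      more-than-itself : 1 < meets x → ∑ᵈ (λ d → boundary d * 1) < ∑ᵈ (λ d → boundary d * 1)
      more-than-itself 1<meets = begin-strict
        ∑ᵈ (λ d → boundary d * 1)             <⟨ ∑-mono-< darts pointwise d₀ d₀-strict ⟩
        ∑ᵈ (λ d → boundary d * meets (vtx d)) ≡⟨ boundary-meets ⟩
        3 * ∑ᵈ (λ e → boundary e * m e)       ≡⟨ boundary-matched ⟨
        ∑ᵈ (λ d → boundary d * 1)             ∎
        where
        open ≤-Reasoning
        d₀-strict : boundary d₀ * 1 < boundary d₀ * meets (vtx d₀)
        d₀-strict rewrite boundary-cut (path-target (proj₁ d₀-leaves)) (proj₂ d₀-leaves)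
                     | meets-shift (proj₁ d₀-leaves) = subst (1 <_) (sym (+-identityʳ (meets x))) 1<meets

    perfect-matching-meets-cut-once : ∀ {x f} → U x ≡ false → IsComponentCut G U x f →
                                      ExactlyOne (M ∘ f)
    perfect-matching-meets-cut-once {x} {f} Ux cut =
      sum-χ≡1⇒ExactlyOne (M ∘ f) (trans (sym (∑-leaving cut m)) (meets-once x Ux))

inj₁≢inj₂ : ∀ {A B : Set} {a : A} {b : B} → inj₁ {B = B} a ≢ inj₂ b
inj₁≢inj₂ ()

module ThreeSumProperties {h k : ℕ} (H : CubicRaw (Fin (suc h))) (u : Fin (suc h))
  (K : CubicRaw (Fin (suc k))) (v : Fin (suc k)) (σ : Fin 3 ↔ Fin 3)
  (cubicH : IsCubic H) (2-connH : TwoConnected H) (cubicK : IsCubic K) (2-connK : TwoConnected K) where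

  G : CubicRaw (Fin h ⊎ Fin k)
  G = ThreeSum H u K v σ

  module H∖u = VertexDeletion H u cubicH 2-connH
  module K∖v = VertexDeletion K v cubicK 2-connK

  private
    to from : Fin 3 → Fin 3
    to   = Inverse.to σ
    from = Inverse.from σ

  partner-H-inside : ∀ {d e} → partner H (H∖u.lift d) ≡ H∖u.lift e →
                     partner G (map₁ inj₁ d) ≡ map₁ inj₁ e
  partner-H-inside {a , j} {a' , i} eq with partner H (punchIn u a , j) | eq
  ... | .(punchIn u a' , i) | refl with u Fin.≟ punchIn u a'
  ...   | yes u≡ = ⊥-elim (punchInᵢ≢i u a' (sym u≡))
  ...   | no  u≢ = cong (λ t → (inj₁ t , i)) (punchOut-punchIn′ u u≢)

  partner-K-inside : ∀ {d e} → partner K (K∖v.lift d) ≡ K∖v.lift e →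
                     partner G (map₁ inj₂ d) ≡ map₁ inj₂ e
  partner-K-inside {b , j} {b' , i} eq with partner K (punchIn v b , j) | eq
  ... | .(punchIn v b' , i) | refl with v Fin.≟ punchIn v b'
  ...   | yes v≡ = ⊥-elim (punchInᵢ≢i v b' (sym v≡))
  ...   | no  v≢ = cong (λ t → (inj₂ t , i)) (punchOut-punchIn′ v v≢)

  partner-H-to-K : ∀ {a j i b l} → partner H (punchIn u a , j) ≡ (u , i) →
                   partner K (v , to i) ≡ (punchIn v b , l) → partner G (inj₁ a , j) ≡ (inj₂ b , l)
  partner-H-to-K {a} {j} {i} {b} {l} eq eq′ with partner H (punchIn u a , j) | eq
  ... | .(u , i) | refl with u Fin.≟ u
  ...   | no u≢u = ⊥-elim (u≢u refl)
  ...   | yes _ with partner K (v , to i) | eq′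
  ...     | .(punchIn v b , l) | refl with v Fin.≟ punchIn v b
  ...       | yes v≡ = ⊥-elim (punchInᵢ≢i v b (sym v≡))
  ...       | no  v≢ = cong (λ t → (inj₂ t , l)) (punchOut-punchIn′ v v≢)

  partner-K-to-H : ∀ {b j i a l} → partner K (punchIn v b , j) ≡ (v , i) →
                   partner H (u , from i) ≡ (punchIn u a , l) → partner G (inj₂ b , j) ≡ (inj₁ a , l)
  partner-K-to-H {b} {j} {i} {a} {l} eq eq′ with partner K (punchIn v b , j) | eq
  ... | .(v , i) | refl with v Fin.≟ v
  ...   | no v≢v = ⊥-elim (v≢v refl)
  ...   | yes _ with partner H (u , from i) | eq′
  ...     | .(punchIn u a , l) | refl with u Fin.≟ punchIn u a
  ...       | yes u≡ = ⊥-elim (punchInᵢ≢i u a (sym u≡))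
  ...       | no  u≢ = cong (λ t → (inj₁ t , l)) (punchOut-punchIn′ u u≢)

  partner-H-cut : ∀ i → partner G (map₁ inj₁ (H∖u.stub i)) ≡ map₁ inj₂ (K∖v.stub (to i))
  partner-H-cut i = partner-H-to-K (H∖u.partner-stub i) (K∖v.partner-x₀ (to i))

  partner-K-cut : ∀ i → partner G (map₁ inj₂ (K∖v.stub i)) ≡ map₁ inj₁ (H∖u.stub (from i))
  partner-K-cut i = partner-K-to-H (K∖v.partner-stub i) (H∖u.partner-x₀ (from i))

  module H-side = H∖u.Embedding G inj₁ inj₁-injective partner-H-inside
  module K-side = K∖v.Embedding G inj₂ inj₂-injective partner-K-inside

  involutive : ∀ d → partner G (partner G d) ≡ d
  involutive (inj₁ a , j) with H∖u.partner-view (a , j)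
  ... | H∖u.inside e p-d =
    trans (cong (partner G) (partner-H-inside p-d)) (partner-H-inside (H∖u.partner-swap p-d))
  ... | H∖u.cut i refl =
    trans (cong (partner G) (partner-H-cut i))
          (trans (partner-K-cut (to i)) (cong (map₁ inj₁ ∘ H∖u.stub) (Inverse.strictlyInverseʳ σ i)))
  involutive (inj₂ b , j) with K∖v.partner-view (b , j)
  ... | K∖v.inside e p-d =
    trans (cong (partner G) (partner-K-inside p-d)) (partner-K-inside (K∖v.partner-swap p-d))
  ... | K∖v.cut i refl =
    trans (cong (partner G) (partner-K-cut i))
          (trans (partner-H-cut (from i)) (cong (map₁ inj₂ ∘ K∖v.stub) (Inverse.strictlyInverseˡ σ i)))

  no-fixpoint : ∀ d → partner G d ≢ d
  no-fixpoint (inj₁ a , j) p-d≡d with H∖u.partner-view (a , j)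
  ... | H∖u.inside e p-d = proj₂ cubicH _
    (trans p-d (cong H∖u.lift (H-side.embed-injective (trans (sym (partner-H-inside p-d)) p-d≡d))))
  ... | H∖u.cut i refl = inj₁≢inj₂ (sym (cong proj₁ (trans (sym (partner-H-cut i)) p-d≡d)))
  no-fixpoint (inj₂ b , j) p-d≡d with K∖v.partner-view (b , j)
  ... | K∖v.inside e p-d = proj₂ cubicK _
    (trans p-d (cong K∖v.lift (K-side.embed-injective (trans (sym (partner-K-inside p-d)) p-d≡d))))
  ... | K∖v.cut i refl = inj₁≢inj₂ (cong proj₁ (trans (sym (partner-K-cut i)) p-d≡d))

  cubic : IsCubic G
  cubic = involutive , no-fixpoint

  covers : ∀ (x : Fin h ⊎ Fin k) → (∃ λ a → x ≡ inj₁ a) ⊎ (∃ λ b → x ≡ inj₂ b)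
  covers (inj₁ a) = inj₁ (a , refl)
  covers (inj₂ b) = inj₂ (b , refl)

  module H-first = StubGluing G involutive H u cubicH 2-connH K v cubicK 2-connK inj₁ inj₂
    inj₁-injective inj₂-injective inj₁≢inj₂ covers partner-H-inside partner-K-inside to partner-H-cut
  module K-first = StubGluing G involutive K v cubicK 2-connK H u cubicH 2-connH inj₂ inj₁
    inj₂-injective inj₁-injective (inj₁≢inj₂ ∘ sym) (swap ∘ covers)
    partner-K-inside partner-H-inside from partner-K-cut

  bridgeless : ∀ d x y → Path G (λ _ → ⊤) (AvoidEdge G d) x y
  bridgeless (inj₁ a , j) with H∖u.partner-view (a , j)
  ... | H∖u.inside e p-d = H-first.inner-edge-not-bridge p-d
  ... | H∖u.cut i refl   = H-first.cross-edge-not-bridge i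
  bridgeless (inj₂ b , j) with K∖v.partner-view (b , j)
  ... | K∖v.inside e p-d = K-first.inner-edge-not-bridge p-d
  ... | K∖v.cut i refl   = K-first.cross-edge-not-bridge i

  two-connected : TwoConnected G
  two-connected = H-first.connected , bridgeless

  module Bipartising (U : Fin (suc k) → Bool) (K-bipartising : BipartisingSet K U)
                     (Uv : U v ≡ false) (v-isolated : ∀ y → InComp K U v y → y ≡ v) where

    UG : Fin h ⊎ Fin k → Bool
    UG = liftU v U

    private
      K-contraction : ContractionBipartiteCubic K U
      K-contraction = proj₂ K-bipartising

    K-component-sym : ∀ {x y} → InComp K U x y → InComp K U y x
    K-component-sym = path-sym (proj₁ cubicK) λ _ _ → tt

    neighbour-of-v-in-U : ∀ i → U (punchIn v (K∖v.neighbour i)) ≡ true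
    neighbour-of-v-in-U i with U (punchIn v (K∖v.neighbour i)) in U-nb
    ... | true  = refl
    ... | false = ⊥-elim (punchInᵢ≢i v _ (v-isolated _
          (subst (InComp K U v) (cong vtx (K∖v.partner-x₀ i))
            (edge-path (v , i) Uv tt (subst (λ y → U y ≡ false) (sym (cong vtx (K∖v.partner-x₀ i))) U-nb)))))

    H-component⇒ : ∀ {y z} → InComp G UG y z → ∀ a → y ≡ inj₁ a → ∃ λ a' → z ≡ inj₁ a'
    H-component⇒ (here _) a refl = a , refl
    H-component⇒ (step j _ _ rest) a refl with H∖u.partner-view (a , j)
    ... | H∖u.inside e p-d = H-component⇒ rest (proj₁ e) (cong vtx (partner-H-inside p-d))
    ... | H∖u.cut i refl = ⊥-elim (true≢false (trans (sym (neighbour-of-v-in-U (to i)))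
            (subst (λ x → UG x ≡ false) (cong vtx (partner-H-cut i)) (path-source rest))))

    H-component⇐ : ∀ a a' → InComp G UG (inj₁ a) (inj₁ a')
    H-component⇐ = H-side.embedded-connected (λ _ → refl) (λ _ _ _ → tt)

    K-component⇒ : ∀ {y z} → InComp G UG y z → ∀ b → y ≡ inj₂ b →
                   ∃ λ c → z ≡ inj₂ c × InComp K U (punchIn v b) (punchIn v c)
    K-component⇒ (here Ub) b refl = b , refl , here Ub
    K-component⇒ (step j Ub _ rest) b refl with K∖v.partner-view (b , j)
    ... | K∖v.cut i refl = ⊥-elim (true≢false (trans (sym (neighbour-of-v-in-U i)) Ub))
    ... | K∖v.inside e p-d with K-component⇒ rest (proj₁ e) (cong vtx (partner-K-inside p-d))
    ...   | c , refl , walk =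
      c , refl , step j Ub tt (subst (λ y → InComp K U y _) (sym (cong vtx p-d)) walk)

    K-component⇐ : ∀ {y z} → InComp K U y z → ∀ b → y ≡ punchIn v b →
                   ∃ λ c → z ≡ punchIn v c × InComp G UG (inj₂ b) (inj₂ c)
    K-component⇐ (here Ub) b refl = b , refl , here Ub
    K-component⇐ (step j Ub _ rest) b refl with K∖v.partner-view (b , j)
    ... | K∖v.cut i refl = ⊥-elim (true≢false (trans (sym (neighbour-of-v-in-U i)) Ub))
    ... | K∖v.inside e p-d with K-component⇐ rest (proj₁ e) (cong vtx p-d)
    ...   | c , refl , walk =
      c , refl , step j Ub tt (subst (λ y → InComp G UG y _) (sym (cong vtx (partner-K-inside p-d))) walk)

    two-in-U : Σ (Fin h ⊎ Fin k) λ x → Σ (Fin h ⊎ Fin k) λ y → x ≢ y × UG x ≡ true × UG y ≡ true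
    two-in-U with proj₁ K-bipartising
    ... | x , y , x≢y , Ux , Uy with punchIn-view v x | punchIn-view v y
    ...   | inj₁ refl | _         = ⊥-elim (true≢false (trans (sym Ux) Uv))
    ...   | inj₂ _    | inj₁ refl = ⊥-elim (true≢false (trans (sym Uy) Uv))
    ...   | inj₂ (b , refl) | inj₂ (b' , refl) =
      inj₂ b , inj₂ b' , (λ q → x≢y (cong (punchIn v) (inj₂-injective q))) , Ux , Uy

    independent : Independent G UG
    independent (inj₂ b , j) Ub Upd with K∖v.partner-view (b , j)
    ... | K∖v.inside e p-d = proj₁ K-contraction (K∖v.lift (b , j)) Ub
          (subst (λ d → U (vtx d) ≡ true) (sym p-d)
                 (subst (λ x → UG (vtx x) ≡ true) (partner-K-inside p-d) Upd))
    ... | K∖v.cut i refl = true≢false (sym (subst (λ x → UG (vtx x) ≡ true) (partner-K-cut i) Upd))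

    H-cut : Fin 3 → Dart (Fin h ⊎ Fin k)
    H-cut = map₁ inj₁ ∘ H∖u.stub

    H-cut-is-cut : ∀ a → IsComponentCut G UG (inj₁ a) H-cut
    H-cut-is-cut a =
        (λ i i' q → H∖u.stub-injective (H-side.embed-injective q))
      , (λ i → H-component⇐ a (H∖u.neighbour i)
             , subst (λ x → UG (vtx x) ≡ true) (sym (partner-H-cut i)) (neighbour-of-v-in-U (to i)))
      , complete
      where
      complete : ∀ d → InComp G UG (inj₁ a) (vtx d) → UG (vtx (partner G d)) ≡ true →
                 Σ (Fin 3) λ i → H-cut i ≡ d
      complete (x , j) walk Upd with H-component⇒ walk a refl
      ... | a' , refl with H∖u.partner-view (a' , j)
      ...   | H∖u.inside e p-d =
        ⊥-elim (true≢false (sym (subst (λ x → UG (vtx x) ≡ true) (partner-H-inside p-d) Upd)))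
      ...   | H∖u.cut i refl   = i , refl

    module K-cut (b : Fin k) (Ub : U (punchIn v b) ≡ false) where

      cutK : Fin 3 → Dart (Fin (suc k))
      cutK = proj₁ (proj₂ (proj₂ K-contraction) (punchIn v b) Ub)

      private
        cutK-is-cut = proj₂ (proj₂ (proj₂ K-contraction) (punchIn v b) Ub)
        cutK-injective = proj₁ cutK-is-cut
        cutK-leaves = proj₁ (proj₂ cutK-is-cut)
        cutK-complete = proj₂ (proj₂ cutK-is-cut)

      off-v : ∀ i → v ≢ vtx (cutK i)
      off-v i v≡ = punchInᵢ≢i v b (v-isolated _
        (K-component-sym (subst (InComp K U _) (sym v≡) (proj₁ (cutK-leaves i)))))

      cut : Fin 3 → Dart (Fin h ⊎ Fin k)
      cut i = inj₂ (punchOut (off-v i)) , proj₂ (cutK i)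

      lift-cut : ∀ i → K∖v.lift (punchOut (off-v i) , proj₂ (cutK i)) ≡ cutK i
      lift-cut i = cong (_, proj₂ (cutK i)) (punchIn-punchOut (off-v i))

      cut-leaves : ∀ i → InComp G UG (inj₂ b) (vtx (cut i)) × (UG (vtx (partner G (cut i))) ≡ true)
      cut-leaves i = inside-component , partner-in-U
        where
        inside-component : InComp G UG (inj₂ b) (inj₂ (punchOut (off-v i)))
        inside-component with K-component⇐ (proj₁ (cutK-leaves i)) b refl
        ... | c , at-c , walk = subst (λ c′ → InComp G UG (inj₂ b) (inj₂ c′))
                                  (punchIn-injective v c _ (trans (sym at-c) (sym (cong vtx (lift-cut i))))) walk
        partner-in-U : UG (vtx (partner G (cut i))) ≡ true
        partner-in-U with K∖v.partner-view (punchOut (off-v i) , proj₂ (cutK i))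
        ... | K∖v.inside e p-d = subst (λ x → UG (vtx x) ≡ true) (sym (partner-K-inside p-d))
              (subst (λ d → U (vtx d) ≡ true) (trans (cong (partner K) (sym (lift-cut i))) p-d)
                     (proj₂ (cutK-leaves i)))
        ... | K∖v.cut i' at-stub = ⊥-elim (true≢false (trans (sym (neighbour-of-v-in-U i'))
              (subst (λ d → U (punchIn v (proj₁ d)) ≡ false) at-stub
                (subst (λ d → U (vtx d) ≡ false) (sym (lift-cut i)) (path-target (proj₁ (cutK-leaves i)))))))

      cut-complete : ∀ d → InComp G UG (inj₂ b) (vtx d) → UG (vtx (partner G d)) ≡ true →
                     Σ (Fin 3) λ i → cut i ≡ d
      cut-complete (x , j) walk Upd with K-component⇒ walk b refl
      ... | c , refl , walkK with K∖v.partner-view (c , j)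
      ...   | K∖v.cut i refl = ⊥-elim (true≢false (trans (sym (neighbour-of-v-in-U i)) (path-target walkK)))
      ...   | K∖v.inside e p-d with cutK-complete (K∖v.lift (c , j)) walkK
                                     (subst (λ d → U (vtx d) ≡ true) (sym p-d)
                                       (subst (λ x → UG (vtx x) ≡ true) (partner-K-inside p-d) Upd))
      ...     | i , at-i = i , cong (map₁ inj₂) (K∖v.lift-injective (trans (lift-cut i) at-i))

      cut-is-cut : IsComponentCut G UG (inj₂ b) cut
      cut-is-cut = (λ i i' q → cutK-injective i i' (trans (sym (lift-cut i))
                                 (trans (cong K∖v.lift (K-side.embed-injective q)) (lift-cut i'))))
                 , cut-leaves , cut-complete

    contraction : ContractionBipartiteCubic G UG
    contraction = independent , (λ d Ud Upd → edge-path d Ud tt Upd) , cuts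
      where
      cuts : ∀ x → UG x ≡ false → Σ (Fin 3 → Dart (Fin h ⊎ Fin k)) (IsComponentCut G UG x)
      cuts (inj₁ a) _  = H-cut , H-cut-is-cut a
      cuts (inj₂ b) Ub = K-cut.cut b Ub , K-cut.cut-is-cut b Ub

    quasi-bipartite : QuasiBipartiteWith G UG
    quasi-bipartite = two-connected , two-in-U , contraction

    H-component : ∀ a z → InComp G UG (inj₁ a) z ⇔ ∃ λ a' → z ≡ inj₁ a'
    H-component a z = mk⇔ (λ walk → H-component⇒ walk a refl) λ { (a' , refl) → H-component⇐ a a' }

    K-component : ∀ b z → InComp G UG (inj₂ b) z ⇔
                          ∃ λ c → z ≡ inj₂ c × InComp K U (punchIn v b) (punchIn v c)
    K-component b z = mk⇔ (λ walk → K-component⇒ walk b refl) from-K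
      where
      from-K : (∃ λ c → z ≡ inj₂ c × InComp K U (punchIn v b) (punchIn v c)) → InComp G UG (inj₂ b) z
      from-K (c , refl , walkK) with K-component⇐ walkK b refl
      ... | c′ , at-c′ , walk =
        subst (λ c″ → InComp G UG (inj₂ b) (inj₂ c″)) (sym (punchIn-injective v c c′ at-c′)) walk

    H-dart : Dart (Fin (suc h)) → Dart (Fin h ⊎ Fin k)
    H-dart (x , j) with u Fin.≟ x
    ... | yes _   = H-cut j
    ... | no  u≢x = inj₁ (punchOut u≢x) , j

    H-dart-u : ∀ j → H-dart (u , j) ≡ H-cut j
    H-dart-u j with u Fin.≟ u
    ... | yes _   = refl
    ... | no  u≢u = ⊥-elim (u≢u refl)

    H-dart-lift : ∀ d → H-dart (H∖u.lift d) ≡ map₁ inj₁ d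
    H-dart-lift (a , j) with u Fin.≟ punchIn u a
    ... | yes u≡ = ⊥-elim (punchInᵢ≢i u a (sym u≡))
    ... | no  u≢ = cong (λ t → (inj₁ t , j)) (punchOut-punchIn′ u u≢)

    H-dart-partner-inside : ∀ {d e} → partner H (H∖u.lift d) ≡ H∖u.lift e →
                            H-dart (partner H (H∖u.lift d)) ≡ partner G (H-dart (H∖u.lift d))
    H-dart-partner-inside {d} {e} p-d = begin
      H-dart (partner H (H∖u.lift d)) ≡⟨ cong H-dart p-d ⟩
      H-dart (H∖u.lift e)             ≡⟨ H-dart-lift e ⟩
      map₁ inj₁ e                     ≡⟨ partner-H-inside p-d ⟨
      partner G (map₁ inj₁ d)         ≡⟨ cong (partner G) (H-dart-lift d) ⟨
      partner G (H-dart (H∖u.lift d)) ∎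
      where open ≡-Reasoning

    H-dart-partner : ∀ d → H-dart (partner H d) ≡ H-dart d ⊎ H-dart (partner H d) ≡ partner G (H-dart d)
    H-dart-partner (x , j) with punchIn-view u x
    ... | inj₁ refl =
      inj₁ (trans (cong H-dart (H∖u.partner-x₀ j)) (trans (H-dart-lift _) (sym (H-dart-u j))))
    ... | inj₂ (a , refl) with H∖u.partner-view (a , j)
    ...   | H∖u.inside e p-d = inj₂ (H-dart-partner-inside p-d)
    ...   | H∖u.cut i refl   = inj₁ (trans (cong H-dart (H∖u.partner-stub i))
                                           (trans (H-dart-u i) (sym (H-dart-lift (H∖u.stub i)))))

    finite : Finite (Fin h ⊎ Fin k)
    finite = record { size = h + k ; enumeration = +↔⊎ }

    module _ (component? : ∀ x y → Dec (InComp G UG x y)) where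

      open ComponentCuts finite G cubic UG contraction component?

      restrict-perfect : ∀ {M} → PerfectMatching G M → PerfectMatching H (M ∘ H-dart)
      restrict-perfect {M} perfect = closed , vertex
        where
        closed : ∀ d → M (H-dart (partner H d)) ≡ M (H-dart d)
        closed d with H-dart-partner d
        ... | inj₁ eq = cong M eq
        ... | inj₂ eq = trans (cong M eq) (proj₁ perfect (H-dart d))
        vertex : ∀ x → ExactlyOne (λ i → M (H-dart (x , i)))
        vertex x with punchIn-view u x
        ... | inj₁ refl = ExactlyOne-≗ (λ i → cong M (sym (H-dart-u i)))
          (perfect-matching-meets-cut-once M perfect refl (H-cut-is-cut (H∖u.neighbour zero)))
        ... | inj₂ (a , refl) =
          ExactlyOne-≗ (λ i → cong M (sym (H-dart-lift (a , i)))) (proj₂ perfect (inj₁ a))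

      restrict-cover : ∀ {n} → PMIndexAtMost G n → PMIndexAtMost H n
      restrict-cover (Ms , ≤n , perfect , covers) =
          List.map (_∘ H-dart) Ms
        , ≤-trans (≤-reflexive (length-map (_∘ H-dart) Ms)) ≤n
        , All.map⁺ (All.map restrict-perfect perfect)
        , λ d → Any.map⁺ (covers (H-dart d))

    -- The conclusion is a negation, so the components of G - U may be assumed decidable.
    perfect-matching-index : PMIndexAtLeast5 H → PMIndexAtLeast5 G
    perfect-matching-index π≥5 cover =
      ¬¬-∀ finite (λ x → ¬¬-∀ finite λ y → ¬¬-excluded-middle)
        λ component? → π≥5 (restrict-cover component? cover)

theorem6p8 : (h k : ℕ)
    → (H : CubicRaw (Fin (suc h))) → (u : Fin (suc h))
    → (K : CubicRaw (Fin (suc k))) → (v : Fin (suc k))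
    → (U : Fin (suc k) → Bool)
    → (σ : Fin 3 ↔ Fin 3)
    → IsCubic H → Snark H → PMIndexAtLeast5 H
    → IsCubic K → ThreeEdgeColourable K → QuasiBipartiteWith K U
    → U v ≡ false → (∀ (y : Fin (suc k)) → InComp K U v y → y ≡ v)
    → PMIndexAtLeast5 (ThreeSum H u K v σ)
      × (QuasiBipartiteWith (ThreeSum H u K v σ) (liftU v U)
         × Σ (Fin h) (λ a → ∀ (z : Fin h ⊎ Fin k) →
             InComp (ThreeSum H u K v σ) (liftU v U) (inj₁ a) z
               ⇔ ∃ (λ b → z ≡ inj₁ b))
         × (∀ (b : Fin k) → U (punchIn v b) ≡ false → ∀ (z : Fin h ⊎ Fin k) →
             InComp (ThreeSum H u K v σ) (liftU v U) (inj₂ b) z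
               ⇔ ∃ (λ c → (z ≡ inj₂ c) × InComp K U (punchIn v b) (punchIn v c))))
theorem6p8 h k H u K v U σ cubicH (2-connH , _) π≥5 cubicK _ (2-connK , bipartising) Uv v-isolated =
    perfect-matching-index π≥5
  , quasi-bipartite
  , (H∖u.neighbour zero , H-component _)
  , λ b _ → K-component b
  where
  open ThreeSumProperties H u K v σ cubicH 2-connH cubicK 2-connK
  open Bipartising U bipartising Uv v-isolated
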